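{- There exist a set $X$ and a multirelation $R$ over $X$ such that $R^{(\ast)}$ is not a fixpoint of the map $F_R:T\mapsto 1_\sigma\cup R\cdot T$.
   Context: A multirelation over $X$ is a subset of $X\times 2^X$. For multirelations $R,S$: $R\cdot S=\{(a,A)\mid \exists B.\,(a,B)\in R\wedge\exists f:B\to 2^X.\,(\forall b\in B.\,(b,f(b))\in S)\wedge A=\bigcup_{b\in B}f(b)\}$; $1_\sigma=\{(a,\{a\})\mid a\in X\}$. Define $R^{(0)}=\emptyset$, $R^{(n+1)}=1_\sigma\cup R\cdot R^{(n)}$ and $R^{(\ast)}=\bigcup_{n\in\mathbb{N}}R^{(n)}$. -}

module Defs where

open import Data.Nat using (ℕ; zero; suc)
open import Data.Product using (Σ; _×_; _,_)
open import Data.Sum using (_⊎_)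
open import Data.Empty.Polymorphic using (⊥)
open import Level using (Level; _⊔_) renaming (suc to lsuc; zero to lzero)
open import Relation.Binary.PropositionalEquality using (_≡_)

Subset : Set → Set₁
Subset X = X → Set

_≐_ : {X : Set} → Subset X → Subset X → Set
A ≐ B = ∀ x → (A x → B x) × (B x → A x)

⋃ : {X : Set} → Subset X → (X → Subset X) → Subset X
⋃ {X} B f x = Σ X λ b → B b × f b x

｛_｝ : {X : Set} → X → Subset X
｛ a ｝ x = a ≡ x

-- A multirelation over X: a subset of X × 2^X.
Multirel : Set → Set₂
Multirel X = X → Subset X → Set₁

_·_ : {X : Set} → Multirel X → Multirel X → Multirel X
_·_ {X} R S a A =
  Σ (Subset X) λ B → R a B ×
    Σ (X → Subset X) λ f → (∀ b → B b → S b (f b)) × (A ≐ ⋃ B f)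

1σ : {X : Set} → Multirel X
1σ a A = Lift1 (A ≐ ｛ a ｝)
  where
  open import Level using (Lift)
  Lift1 : Set → Set₁
  Lift1 P = Lift (lsuc lzero) P

_∪_ : {X : Set} → Multirel X → Multirel X → Multirel X
(R ∪ S) a A = R a A ⊎ S a A

∅ : {X : Set} → Multirel X
∅ a A = ⊥

F : {X : Set} → Multirel X → Multirel X → Multirel X
F R T = 1σ ∪ (R · T)

iter : {X : Set} → Multirel X → ℕ → Multirel X
iter R zero = ∅
iter R (suc n) = F R (iter R n)

star : {X : Set} → Multirel X → Multirel X
star R a A = Σ ℕ λ n → iter R n a A

_≡ₘ_ : {X : Set} → Multirel X → Multirel X → Set₁
R ≡ₘ S = ∀ a A → (R a A → S a A) × (S a A → R a A)

-- Take R on X = Maybe ℕ where `just (suc m)` steps to {just m}, `just 0` has no successor,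
-- and `nothing` fans out to {just n | n ∈ ℕ}.  Then (just n, {just 0}) ∈ R^(n+1), so
-- (nothing, {just 0}) ∈ 1σ ∪ R · R^(∗).  But in R^(j+1) every outcome of a step from
-- `nothing` must pass through `just j`, which cannot reach `just 0` within j stages,
-- so (nothing, {just 0}) ∉ R^(∗).
module Submission where

open import Defs
open import Data.Product using (Σ; _×_; _,_; proj₁; proj₂)
open import Data.Sum using (inj₁; inj₂)
open import Data.Maybe using (Maybe; just; nothing)
open import Data.Nat using (ℕ; zero; suc; _+_; _<_; s≤s)
open import Data.Nat.Properties using (m≤n+m; +-identityʳ; <-irrefl)
open import Data.Empty using () renaming (⊥ to ⊥₀)
open import Level using (Lift; lift)
open import Relation.Nullary using (¬_)
open import Relation.Binary.PropositionalEquality using (_≡_; refl; sym)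

≐-refl : {X : Set} {A : Subset X} → A ≐ A
≐-refl x = (λ p → p) , (λ p → p)

·-const : {X : Set} {R S : Multirel X} {a : X} {B A : Subset X} →
          R a B → Σ X B → (∀ b → B b → S b A) → (R · S) a A
·-const {B = B} {A} Rab (b₀ , Bb₀) SbA =
  B , Rab , (λ _ → A) , SbA ,
  (λ x → (λ Ax → b₀ , Bb₀ , Ax) , (λ { (_ , _ , Ax) → Ax }))

countdown : Multirel (Maybe ℕ)
countdown nothing        B = Lift _ (∀ n → B (just n))
countdown (just zero)    B = Lift _ ⊥₀
countdown (just (suc m)) B = Lift _ (B ≐ ｛ just m ｝)

iter-countdown-reaches-zero : ∀ n → iter countdown (suc n) (just n) ｛ just 0 ｝
iter-countdown-reaches-zero zero    = inj₁ (lift ≐-refl)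
iter-countdown-reaches-zero (suc n) =
  inj₂ (·-const {R = countdown} {S = iter countdown (suc n)} {a = just (suc n)}
                (lift ≐-refl) (just n , refl)
                (λ { _ refl → iter-countdown-reaches-zero n }))

iter-countdown-bound : ∀ j n A → iter countdown j (just n) A →
                       Σ ℕ λ y → A (just y) × n < j + y
iter-countdown-bound (suc j) n A (inj₁ (lift A≐n)) =
  n , proj₂ (A≐n (just n)) refl , s≤s (m≤n+m n j)
iter-countdown-bound (suc j) (suc m) A (inj₂ (B , lift B≐m , f , Sf , A≐⋃))
  with iter-countdown-bound j m (f (just m)) (Sf (just m) (proj₂ (B≐m (just m)) refl))
... | y , fm-y , m<j+y =
  y , proj₂ (A≐⋃ (just y)) (just m , proj₂ (B≐m (just m)) refl , fm-y) , s≤s m<j+y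

root-∉-star : ¬ star countdown nothing ｛ just 0 ｝
root-∉-star (suc j , inj₁ (lift A≐root)) with proj₂ (A≐root nothing) refl
... | ()
root-∉-star (suc j , inj₂ (B , lift allB , f , Sf , A≐⋃))
  with iter-countdown-bound j j (f (just j)) (Sf (just j) (allB j))
... | y , fj-y , j<j+y with proj₂ (A≐⋃ (just y)) (just j , allB j , fj-y)
... | refl = <-irrefl (sym (+-identityʳ j)) j<j+y

root-∈-F-star : F countdown (star countdown) nothing ｛ just 0 ｝
root-∈-F-star =
  inj₂ (·-const {R = countdown} {S = star countdown} {a = nothing}
                {B = λ x → Σ ℕ λ n → just n ≡ x}
                (lift (λ n → n , refl)) (just 0 , 0 , refl)
                (λ { _ (n , refl) → suc n , iter-countdown-reaches-zero n }))

lemma13p5 : Σ Set λ X → Σ (Multirel X) λ R → ¬ (F R (star R) ≡ₘ star R)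
lemma13p5 = Maybe ℕ , countdown ,
  λ F*≡* → root-∉-star (proj₁ (F*≡* nothing ｛ just 0 ｝) root-∈-F-star)
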